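{- Let $0<m\le n$ and $\alpha=(a_1,\dots,a_m)\in[n]^m$. Then $\alpha$ is a $1$-metered $(m,n)$-parking function if and only if every entry of $\alpha$ equal to $n$ is the first entry of a lace in the lace decomposition of $\alpha$.
   Context: Let $[n]=\{1,\dots,n\}$. For a nonnegative integer $t$, a preference list $\alpha=(a_1,\dots,a_m)\in[n]^m$ is processed by the $t$-metered parking scheme: there are $n$ spots $1,\dots,n$ on a one-way street; cars $1,\dots,m$ arrive in order; car $i$ drives to spot $a_i$, parks there if it is unoccupied, and otherwise parks in the first unoccupied spot numbered greater than $a_i$; if there is none, the car fails to park. Immediately after car $j$ parks, car $j-t$ (if $j-t\ge1$) leaves the street. $\alpha$ is a $t$-metered $(m,n)$-parking function if all $m$ cars park. A lace of length $\ell\ge2$ is a sequence of the form $(p,p,p+1,p+2,\dots,p+\ell-2)$ for a positive integer $p$; a singleton $(p)$ is a lace of length $1$. The lace decomposition of $\alpha$ is obtained by partitioning $\alpha$, from left to right, into consecutive blocks of consecutively indexed entries, each block being a maximally long lace (i.e., starting from the first entry not yet assigned, take the longest run of consecutive entries forming a lace). -}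

module Defs where

open import Data.Nat using (ℕ; zero; suc; _∸_; _≤_; _≡ᵇ_)
open import Data.Bool using (Bool; true; false; if_then_else_; _∨_)
open import Data.List using (List; []; _∷_; length; _++_; drop)
open import Data.Bool.ListAction using (any)
open import Data.List.Relation.Unary.All using (All)
open import Data.Maybe using (Maybe; just; nothing)
open import Data.Product using (_×_; _,_; proj₁; proj₂)
open import Relation.Binary.PropositionalEquality using (_≡_; _≢_)

occupied : List ℕ → ℕ → Bool
occupied street s = any (λ x → x ≡ᵇ s) street

searchFrom : List ℕ → ℕ → ℕ → Maybe ℕ
searchFrom street s zero = nothing
searchFrom street s (suc k) =
  if occupied street s then searchFrom street (suc s) k else just s

spotFor : ℕ → List ℕ → ℕ → Maybe ℕ
spotFor n street a = searchFrom street a (suc n ∸ a)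

keepLast : ℕ → List ℕ → List ℕ
keepLast t xs = drop (length xs ∸ t) xs

-- `street` lists the spots of the cars currently parked, oldest first.
-- After car j parks, car j - t leaves, so exactly the last (at most) t
-- cars remain on the street.
allPark : ℕ → ℕ → List ℕ → List ℕ → Bool
allPark t n street [] = true
allPark t n street (a ∷ as) with spotFor n street a
... | nothing = false
... | just s  = allPark t n (keepLast t (street ++ (s ∷ []))) as

InRange : ℕ → ℕ → Set
InRange n a = (1 ≤ a) × (a ≤ n)

IsMeteredPF : ℕ → ℕ → ℕ → List ℕ → Set
IsMeteredPF t m n α =
  (length α ≡ m) × All (InRange n) α × (allPark t n [] α ≡ true)

extend : ℕ → List ℕ → List ℕ × List ℕ
extend q [] = [] , []
extend q (x ∷ xs) with x ≡ᵇ q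
... | true  = let r = extend (suc q) xs in (x ∷ proj₁ r) , proj₂ r
... | false = [] , (x ∷ xs)

decompFuel : ℕ → List ℕ → List (List ℕ)
decompFuel zero xs = []
decompFuel (suc k) [] = []
decompFuel (suc k) (x ∷ []) = (x ∷ []) ∷ []
decompFuel (suc k) (x ∷ y ∷ rest) with x ≡ᵇ y
... | true  = let r = extend (suc x) rest
              in (x ∷ y ∷ proj₁ r) ∷ decompFuel k (proj₂ r)
... | false = (x ∷ []) ∷ decompFuel k (y ∷ rest)

laceDecomposition : List ℕ → List (List ℕ)
laceDecomposition α = decompFuel (length α) α

NOnlyFirst : ℕ → List ℕ → Set
NOnlyFirst n [] = Data.Unit.⊤ where import Data.Unit
NOnlyFirst n (x ∷ xs) = All (λ y → y ≢ n) xs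

EveryNStartsLace : ℕ → List ℕ → Set
EveryNStartsLace n α = All (NOnlyFirst n) (laceDecomposition α)

-- With one car on the street, a car whose preference differs from the occupied
-- spot parks at its preference, while a car preferring the occupied spot p is
-- pushed to p + 1, which fails exactly when p = n.  So the street always holds
-- a single car, and along each lace (p, p, p+1, ...) of the decomposition the
-- cars are pushed to p+1, p+2, ... in turn: every car parks iff no entry after
-- the first of a lace equals n.
module Submission where

open import Defs
open import Data.Nat using (ℕ; zero; suc; _<_; _≤_; _≡ᵇ_; s≤s)
open import Data.Nat.Properties using (≡⇒≡ᵇ; +-∸-assoc; n∸n≡0; ≤-refl; ≤∧≢⇒<; <⇒≤; 1+n≢n; m≤n⇒m≤1+n; _≟_)
open import Data.Bool using (false; true; _∨_)
open import Data.Bool.Properties using (T-≡)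
open import Data.List using (List; []; _∷_; length; _++_)
open import Data.List.Relation.Unary.All using (All; []; _∷_; tail)
open import Data.Maybe using (just; nothing)
open import Data.Product using (_,_; proj₁; proj₂)
open import Function using (_∘_)
open import Function.Bundles using (_⇔_; mk⇔; Equivalence)
open import Function.Related.Propositional using (module EquationalReasoning)
open import Relation.Nullary using (yes; no; contradiction)
open import Relation.Binary.PropositionalEquality using (_≡_; _≢_; refl; sym; trans; cong)

≡ᵇ-refl : ∀ n → (n ≡ᵇ n) ≡ true
≡ᵇ-refl n = Equivalence.to T-≡ (≡⇒≡ᵇ n n refl)

≢⇒≡ᵇ-false : ∀ {m n} → m ≢ n → (m ≡ᵇ n) ≡ false
≢⇒≡ᵇ-false {zero}  {zero}  m≢n = contradiction refl m≢n
≢⇒≡ᵇ-false {zero}  {suc n} _   = refl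
≢⇒≡ᵇ-false {suc m} {zero}  _   = refl
≢⇒≡ᵇ-false {suc m} {suc n} m≢n = ≢⇒≡ᵇ-false (m≢n ∘ cong suc)

≡true-cong : ∀ {a b} → a ≡ b → (a ≡ true) ⇔ (b ≡ true)
≡true-cong a≡b = mk⇔ (trans (sym a≡b)) (trans a≡b)

occupied-≢ : ∀ {q x} → x ≢ q → occupied (q ∷ []) x ≡ false
occupied-≢ x≢q = cong (_∨ false) (≢⇒≡ᵇ-false (x≢q ∘ sym))

spotFor-free : ∀ {n st a} → a ≤ n → occupied st a ≡ false → spotFor n st a ≡ just a
spotFor-free a≤n free rewrite +-∸-assoc 1 a≤n | free = refl

spotFor-next : ∀ {n a} → a < n → spotFor n (a ∷ []) a ≡ just (suc a)
spotFor-next {a = a} a<n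
  rewrite +-∸-assoc 1 (<⇒≤ a<n) | ≡ᵇ-refl a | +-∸-assoc 1 a<n | ≢⇒≡ᵇ-false (1+n≢n {a} ∘ sym) = refl

spotFor-last : ∀ n → spotFor n (n ∷ []) n ≡ nothing
spotFor-last n rewrite +-∸-assoc 1 (≤-refl {n}) | ≡ᵇ-refl n | n∸n≡0 n = refl

allPark-parks : ∀ {t n s} st a as → spotFor n st a ≡ just s →
  allPark t n st (a ∷ as) ≡ allPark t n (keepLast t (st ++ s ∷ [])) as
allPark-parks st a as spot rewrite spot = refl

allPark-stuck : ∀ {t n} st a as → spotFor n st a ≡ nothing → allPark t n st (a ∷ as) ≡ false
allPark-stuck st a as spot rewrite spot = refl

decompFuel-[] : ∀ k → decompFuel k [] ≡ []
decompFuel-[] zero    = refl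
decompFuel-[] (suc k) = refl

decompFuel-cons : ∀ k x ys →
  decompFuel (suc k) (x ∷ ys) ≡ (x ∷ proj₁ (extend x ys)) ∷ decompFuel k (proj₂ (extend x ys))
decompFuel-cons k x [] = cong (_ ∷_) (sym (decompFuel-[] k))
decompFuel-cons k x (y ∷ ys) with y ≟ x
... | yes refl rewrite ≡ᵇ-refl y = refl
... | no y≢x rewrite ≢⇒≡ᵇ-false y≢x | ≢⇒≡ᵇ-false (y≢x ∘ sym) = refl

module _ {n : ℕ} where
  open EquationalReasoning

  -- The fuel bound length xs ≤ k makes decompFuel (suc k) the full lace
  -- decomposition of q ∷ xs.
  allPark-after⇔ : ∀ k q xs → length xs ≤ k → q ≤ n → All (InRange n) xs →
    (allPark 1 n (q ∷ []) xs ≡ true) ⇔ All (NOnlyFirst n) (decompFuel (suc k) (q ∷ xs))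
  allPark-after⇔ k q [] _ _ _ = mk⇔ (λ _ → [] ∷ []) (λ _ → refl)
  allPark-after⇔ (suc k) q (x ∷ xs) (s≤s len) q≤n ((_ , x≤n) ∷ rng) with x ≟ q
  ... | no x≢q rewrite ≢⇒≡ᵇ-false (x≢q ∘ sym) = begin
    allPark 1 n (q ∷ []) (x ∷ xs) ≡ true
      ∼⟨ ≡true-cong (allPark-parks (q ∷ []) x xs (spotFor-free x≤n (occupied-≢ x≢q))) ⟩
    allPark 1 n (x ∷ []) xs ≡ true
      ∼⟨ allPark-after⇔ k x xs len x≤n rng ⟩
    All (NOnlyFirst n) (decompFuel (suc k) (x ∷ xs))
      ∼⟨ mk⇔ ([] ∷_) tail ⟩
    All (NOnlyFirst n) ((q ∷ []) ∷ decompFuel (suc k) (x ∷ xs)) ∎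
  ... | yes refl rewrite ≡ᵇ-refl x with x ≟ n
  ...   | yes refl =
    mk⇔ (λ parks → contradiction (trans (sym (allPark-stuck (x ∷ []) x xs (spotFor-last x))) parks) λ ())
        (λ { ((x≢x ∷ _) ∷ _) → contradiction refl x≢x })
  ...   | no x≢n = begin
    allPark 1 n (x ∷ []) (x ∷ xs) ≡ true
      ∼⟨ ≡true-cong (allPark-parks (x ∷ []) x xs (spotFor-next (≤∧≢⇒< q≤n x≢n))) ⟩
    allPark 1 n (suc x ∷ []) xs ≡ true
      ∼⟨ allPark-after⇔ (suc k) (suc x) xs (m≤n⇒m≤1+n len) (≤∧≢⇒< q≤n x≢n) rng ⟩
    All (NOnlyFirst n) (decompFuel (suc (suc k)) (suc x ∷ xs))
      ≡⟨ cong (All (NOnlyFirst n)) (decompFuel-cons (suc k) (suc x) xs) ⟩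
    All (NOnlyFirst n) ((suc x ∷ rest) ∷ decompFuel (suc k) later)
      ∼⟨ mk⇔ (λ { (rest≢n ∷ ok) → (x≢n ∷ rest≢n) ∷ ok }) (λ { ((_ ∷ rest≢n) ∷ ok) → rest≢n ∷ ok }) ⟩
    All (NOnlyFirst n) ((x ∷ x ∷ rest) ∷ decompFuel (suc k) later) ∎
    where
    rest later : List ℕ
    rest = proj₁ (extend (suc x) xs)
    later = proj₂ (extend (suc x) xs)

theorem3p7 : (m n : ℕ) → 0 < m → m ≤ n → (α : List ℕ) → length α ≡ m → All (InRange n) α →
    IsMeteredPF 1 m n α ⇔ EveryNStartsLace n α
theorem3p7 m n _ _ [] len rng = mk⇔ (λ _ → []) (λ _ → len , rng , refl)
theorem3p7 m n _ _ (a ∷ as) len rng@((_ , a≤n) ∷ rng′) = begin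
  IsMeteredPF 1 m n (a ∷ as)
    ∼⟨ mk⇔ (proj₂ ∘ proj₂) (λ parks → len , rng , parks) ⟩
  allPark 1 n [] (a ∷ as) ≡ true
    ∼⟨ ≡true-cong (allPark-parks [] a as (spotFor-free a≤n refl)) ⟩
  allPark 1 n (a ∷ []) as ≡ true
    ∼⟨ allPark-after⇔ (length as) a as ≤-refl a≤n rng′ ⟩
  EveryNStartsLace n (a ∷ as) ∎
  where open EquationalReasoning
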